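{- Let $\omega=e^{2\pi i/3}$ and consider $\mathbb{C}^6$ with coordinates $(X,Y,Z,\varphi,Q_1,Q_2)$. Define the linear maps $A,B,C,E:\mathbb{C}^6\to\mathbb{C}^6$ by $$A(X,Y,Z,\varphi,Q_1,Q_2)=(Y,Z,X,\varphi,Q_1,Q_2),\qquad B(X,Y,Z,\varphi,Q_1,Q_2)=(X,Z,Y,\varphi,Q_2,Q_1),$$ $$C(X,Y,Z,\varphi,Q_1,Q_2)=(X,Y,Z,\varphi,\bar\omega Q_1,\omega Q_2),$$ $$E(X,Y,Z,\varphi,Q_1,Q_2)=(\sqrt{ -3})^{ -3}\big(s+6\varphi+3Q_1+3Q_2,\ s+6\varphi+3\bar\omega Q_1+3\omega Q_2,\ s+6\varphi+3\omega Q_1+3\bar\omega Q_2,\ s-3\varphi,\ 3X+3\bar\omega Y+3\omega Z,\ 3X+3\omega Y+3\bar\omega Z\big),$$ where $s=X+Y+Z$, and let $\mathcal{H}$ be the group generated by $A,B,C,E$. Define the polynomials $$W_2=s^2-12(XY+YZ+ZX),\quad W_3=(X-Y)(Y-Z)(Z-X),\quad \mathfrak{W}_3=XYZ-\varphi^3,$$ $$W_4=s(s^3+216XYZ),\quad \mathfrak{W}_4=\varphi(27XYZ-s^3),\quad W_6=s^6-540XYZ\,s^3-5832X^2Y^2Z^2,$$ $$\mathfrak{V}_3=Q_1^3+Q_2^3-(s+6\varphi)(XY+YZ+ZX)-6\varphi^2 s-9\varphi^3,\qquad \mathfrak{V}_2=Q_1Q_2-(XY+YZ+ZX)-\varphi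 s-3\varphi^2.$$ Then the surface $\Sigma=\{\mathfrak{W}_3=\mathfrak{V}_3=\mathfrak{V}_2=0\}\subset\mathbb{C}^6$ is invariant under $\mathcal{H}$, and each of the curves $$\Sigma\cap\{W_2=0\},\quad \Sigma\cap\{W_3=0\},\quad \Sigma\cap\{W_4=0\},\quad \Sigma\cap\{W_6=0\},\quad \Sigma\cap\{\mathfrak{W}_4=0\}$$ is invariant under $\mathcal{H}$.
   Context: "Invariant under $\mathcal{H}$" means that every element of $\mathcal{H}$ maps the set into itself. The maps $A,B,C,E$ are the actions, on the monomials $X=z_1^3$, $Y=z_2^3$, $Z=z_3^3$, $\varphi=z_1z_2z_3$, $Q_1=z_1z_2^2+z_2z_3^2+z_3z_1^2$, $Q_2=z_1^2z_2+z_2^2z_3+z_3^2z_1$, induced by generators of the Hessian group, but here $(X,Y,Z,\varphi,Q_1,Q_2)$ are treated as independent coordinates. -}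

module Defs where

open import Level using (Level; _⊔_; suc)
open import Data.Nat using (ℕ; zero) renaming (suc to sucℕ)
open import Data.Product using (_×_)
open import Data.Sum using (_⊎_)
open import Relation.Nullary using (¬_)
open import Algebra.Bundles using (CommutativeRing)

-- The ambient scalar ring: an integral domain of characteristic 0 containing
-- a primitive cube root of unity ω (ω² + ω + 1 = 0) and a square root r of -3
-- with r³ invertible (inverse t).  ℂ with ω = e^{2πi/3}, r = √-3 is an instance.
-- n • 1 in a commutative ring
natR : ∀ {c ℓ} (R : CommutativeRing c ℓ) → ℕ → CommutativeRing.Carrier R
natR R zero = CommutativeRing.0# R
natR R (sucℕ n) = CommutativeRing._+_ R (CommutativeRing.1# R) (natR R n)

record Scalars (c ℓ : Level) : Set (suc (c ⊔ ℓ)) where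
  field
    R : CommutativeRing c ℓ
  open CommutativeRing R public
  nat : ℕ → Carrier
  nat = natR R
  field
    integral   : ∀ x y → x * y ≈ 0# → (x ≈ 0#) ⊎ (y ≈ 0#)
    char0      : ∀ n → ¬ (nat (sucℕ n) ≈ 0#)
    ω          : Carrier
    ω-cube     : ω * ω + ω + 1# ≈ 0#
    r          : Carrier
    r-sq       : r * r ≈ - nat 3
    t          : Carrier
    t-inv      : t * (r * (r * r)) ≈ 1#

module Geometry {c ℓ : Level} (K : Scalars c ℓ) where
  open Scalars K

  ω̄ : Carrier
  ω̄ = ω * ω

  record Pt : Set c where
    constructor pt
    field
      X Y Z φ Q₁ Q₂ : Carrier
  open Pt public

  _≈ₚ_ : Pt → Pt → Set ℓ
  p ≈ₚ q = (X p ≈ X q) × (Y p ≈ Y q) × (Z p ≈ Z q) ×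
           (φ p ≈ φ q) × (Q₁ p ≈ Q₁ q) × (Q₂ p ≈ Q₂ q)

  mapA mapB mapC mapE : Pt → Pt
  mapA (pt x y z f q₁ q₂) = pt y z x f q₁ q₂
  mapB (pt x y z f q₁ q₂) = pt x z y f q₂ q₁
  mapC (pt x y z f q₁ q₂) = pt x y z f (ω̄ * q₁) (ω * q₂)
  mapE (pt x y z f q₁ q₂) =
    let s = x + y + z
        k = nat 3
    in pt (t * (s + nat 6 * f + k * q₁ + k * q₂))
          (t * (s + nat 6 * f + k * (ω̄ * q₁) + k * (ω * q₂)))
          (t * (s + nat 6 * f + k * (ω * q₁) + k * (ω̄ * q₂)))
          (t * (s - k * f))
          (t * (k * x + k * (ω̄ * y) + k * (ω * z)))
          (t * (k * x + k * (ω * y) + k * (ω̄ * z)))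

  -- 𝓗 : the group generated by A, B, C, E (as a subset of maps K⁶ → K⁶,
  -- maps identified up to pointwise equality)
  data InH : (Pt → Pt) → Set (c ⊔ ℓ) where
    hA : InH mapA
    hB : InH mapB
    hC : InH mapC
    hE : InH mapE
    hId : InH (λ p → p)
    hComp : ∀ {f g} → InH f → InH g → InH (λ p → f (g p))
    hInv : ∀ {f} → InH f → (h : Pt → Pt) →
           (∀ p → h (f p) ≈ₚ p) → (∀ p → f (h p) ≈ₚ p) → InH h
    hExt : ∀ {f} → InH f → (g : Pt → Pt) → (∀ p → f p ≈ₚ g p) → InH g

  Invariant : (Pt → Set ℓ) → Set (c ⊔ ℓ)
  Invariant S = ∀ g → InH g → ∀ p → S p → S (g p)

  module _ (p : Pt) where
    private
      x = X p ; y = Y p ; z = Z p ; f = φ p ; q₁ = Q₁ p ; q₂ = Q₂ p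
      s = x + y + z
      e₂ = x * y + y * z + z * x
      xyz = x * y * z
      cube : Carrier → Carrier
      cube a = a * a * a
    W₂ W₃ 𝔚₃ W₄ 𝔚₄ W₆ 𝔙₃ 𝔙₂ : Carrier
    W₂ = s * s - nat 12 * e₂
    W₃ = (x - y) * (y - z) * (z - x)
    𝔚₃ = xyz - cube f
    W₄ = s * (cube s + nat 216 * xyz)
    𝔚₄ = f * (nat 27 * xyz - cube s)
    W₆ = cube s * cube s - nat 540 * xyz * cube s - nat 5832 * (xyz * xyz)
    𝔙₃ = cube q₁ + cube q₂ - (s + nat 6 * f) * e₂ - nat 6 * (f * f) * s - nat 9 * cube f
    𝔙₂ = q₁ * q₂ - e₂ - f * s - nat 3 * (f * f)

  Surf : Pt → Set ℓ
  Surf p = (𝔚₃ p ≈ 0#) × (𝔙₃ p ≈ 0#) × (𝔙₂ p ≈ 0#)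

  SurfCut : (Pt → Carrier) → Pt → Set ℓ
  SurfCut F p = Surf p × (F p ≈ 0#)

module Submission where

-- Every polynomial of the statement except W₃ is a polynomial in the invariants
-- s = X + Y + Z, e₂ = XY + YZ + ZX, e₃ = XYZ, φ, P = Q₁Q₂ and Q = Q₁³ + Q₂³, and A, B, C
-- fix these invariants. The coordinates of E p are discrete Fourier transforms over the
-- cube roots of unity, so E acts on the invariants by an explicit polynomial substitution.
-- Under it (𝔙₂, 𝔚₃, 𝔙₃) transform triangularly with nonzero diagonal factors, so E maps Σ
-- onto itself in both directions, as it must because 𝓗 contains inverses. On Σ the
-- invariants are functions of s, e₂ and φ alone, and there E only rescales W₂, W₄, 𝔚₄ and
-- W₆ by nonzero constants. Finally W₃(E p) is a nonzero multiple of Q₁³ − Q₂³, whose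
-- square Q² − 4P³ equals on Σ the discriminant of (T − X)(T − Y)(T − Z), namely W₃².

open import Defs
open import Level using (Level; _⊔_)
open import Algebra.Bundles using (CommutativeRing)
open import Algebra.Bundles.Raw using (RawRing)
open import Algebra.Solver.Ring.AlmostCommutativeRing
  using (fromCommutativeRing; _-Raw-AlmostCommutative⟶_)
open import Data.Empty using (⊥-elim)
open import Data.Integer.Base as ℤ using (ℤ; +_; -[1+_]; _◃_)
import Data.Integer.Properties as ℤ
open import Data.Maybe.Base as Maybe using (Maybe)
open import Data.Nat.Base as ℕ using (ℕ; zero; suc)
open import Data.Product using (_×_; _,_)
open import Data.Product.Function.NonDependent.Propositional using (_×-⇔_)
open import Data.Sign.Base as Sign using (Sign)
open import Data.Sum using (inj₁; inj₂; reduce)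
open import Function.Bundles using (_⇔_; mk⇔; module Equivalence)
open import Function.Construct.Composition using (_⇔-∘_)
open import Function.Construct.Identity using (⇔-id)
open import Function.Construct.Symmetry using (⇔-sym)
open import Relation.Binary.Consequences using (dec⇒weaklyDec)
open import Relation.Binary.Definitions using (_Respects_)
open import Relation.Binary.PropositionalEquality.Core as ≡ using (_≡_)

-- The library's reflective solver takes its coefficients in the ring itself, where the
-- numerals natR R n are opaque; Algebra.Solver.Ring with integer coefficients, interpreted
-- as natR R n and their negatives, normalises numeral arithmetic as well.
module IntegerCoefficients {c ℓ} (R : CommutativeRing c ℓ) where
  open CommutativeRing R
  open import Algebra.Properties.Ring ring
  open import Relation.Binary.Reasoning.Setoid setoid

  private
    nat : ℕ → Carrier
    nat = natR R

  ⟦_⟧ℤ : ℤ → Carrier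
  ⟦ + n ⟧ℤ      = nat n
  ⟦ -[1+ n ] ⟧ℤ = - nat (suc n)

  nat-+ : ∀ m n → nat (m ℕ.+ n) ≈ nat m + nat n
  nat-+ zero    n = sym (+-identityˡ _)
  nat-+ (suc m) n = trans (+-congˡ (nat-+ m n)) (sym (+-assoc _ _ _))

  nat-* : ∀ m n → nat (m ℕ.* n) ≈ nat m * nat n
  nat-* zero    n = sym (zeroˡ _)
  nat-* (suc m) n = begin
    nat (n ℕ.+ m ℕ.* n)        ≈⟨ nat-+ n (m ℕ.* n) ⟩
    nat n + nat (m ℕ.* n)      ≈⟨ +-cong (sym (*-identityˡ _)) (nat-* m n) ⟩
    1# * nat n + nat m * nat n ≈⟨ distribʳ _ _ _ ⟨
    nat (suc m) * nat n        ∎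

  [1+x]-[1+y]≈x-y : ∀ x y → (1# + x) - (1# + y) ≈ x - y
  [1+x]-[1+y]≈x-y x y = begin
    (1# + x) + - (1# + y)   ≈⟨ +-congˡ (-‿anti-homo-+ 1# y) ⟩
    (1# + x) + (- y + - 1#) ≈⟨ +-assoc _ _ _ ⟨
    (1# + x) + - y + - 1#   ≈⟨ +-congʳ (+-assoc _ _ _) ⟩
    1# + (x - y) - 1#       ≈⟨ xyx⁻¹≈y 1# (x - y) ⟩
    x - y                   ∎

  ⊖-homo : ∀ m n → ⟦ m ℤ.⊖ n ⟧ℤ ≈ nat m - nat n
  ⊖-homo zero    zero    = sym (-‿inverseʳ 0#)
  ⊖-homo (suc m) zero    = sym (trans (+-congˡ -0#≈0#) (+-identityʳ _))
  ⊖-homo zero    (suc n) = sym (+-identityˡ _)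
  ⊖-homo (suc m) (suc n) = begin
    ⟦ suc m ℤ.⊖ suc n ⟧ℤ      ≡⟨ ≡.cong ⟦_⟧ℤ (ℤ.[1+m]⊖[1+n]≡m⊖n m n) ⟩
    ⟦ m ℤ.⊖ n ⟧ℤ              ≈⟨ ⊖-homo m n ⟩
    nat m - nat n             ≈⟨ [1+x]-[1+y]≈x-y (nat m) (nat n) ⟨
    nat (suc m) - nat (suc n) ∎

  +-homo : ∀ i j → ⟦ i ℤ.+ j ⟧ℤ ≈ ⟦ i ⟧ℤ + ⟦ j ⟧ℤ
  +-homo (+ m)    (+ n)    = nat-+ m n
  +-homo (+ m)    -[1+ n ] = ⊖-homo m (suc n)
  +-homo -[1+ m ] (+ n)    = trans (⊖-homo n (suc m)) (+-comm _ _)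
  +-homo -[1+ m ] -[1+ n ] = begin
    - (1# + nat (suc m ℕ.+ n))     ≈⟨ -‿cong (+-congˡ (nat-+ (suc m) n)) ⟩
    - (1# + (nat (suc m) + nat n)) ≈⟨ -‿cong (trans (+-congˡ (+-comm _ _)) (sym (+-assoc _ _ _))) ⟩
    - (1# + nat n + nat (suc m))   ≈⟨ -‿+-comm _ _ ⟨
    - nat (suc n) + - nat (suc m)  ≈⟨ +-comm _ _ ⟩
    - nat (suc m) + - nat (suc n)  ∎

  -‿homo : ∀ i → ⟦ ℤ.- i ⟧ℤ ≈ - ⟦ i ⟧ℤ
  -‿homo (+ zero)  = sym -0#≈0#
  -‿homo (+ suc n) = refl
  -‿homo -[1+ n ]  = sym (-‿involutive _)

  signed : Sign → Carrier → Carrier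
  signed Sign.+ x = x
  signed Sign.- x = - x

  signed-cong : ∀ s {x y} → x ≈ y → signed s x ≈ signed s y
  signed-cong Sign.+ x≈y = x≈y
  signed-cong Sign.- x≈y = -‿cong x≈y

  signed-* : ∀ s s′ x y → signed (s Sign.* s′) (x * y) ≈ signed s x * signed s′ y
  signed-* Sign.+ Sign.+ x y = refl
  signed-* Sign.+ Sign.- x y = -‿distribʳ-* x y
  signed-* Sign.- Sign.+ x y = -‿distribˡ-* x y
  signed-* Sign.- Sign.- x y = begin
    x * y       ≈⟨ -‿involutive _ ⟨
    - - (x * y) ≈⟨ -‿cong (-‿distribʳ-* x y) ⟩
    - (x * - y) ≈⟨ -‿distribˡ-* x (- y) ⟩
    - x * - y   ∎

  ◃-homo : ∀ s n → ⟦ s ◃ n ⟧ℤ ≈ signed s (nat n)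
  ◃-homo Sign.+ zero    = refl
  ◃-homo Sign.- zero    = sym -0#≈0#
  ◃-homo Sign.+ (suc n) = refl
  ◃-homo Sign.- (suc n) = refl

  signed-sign-abs : ∀ i → signed (ℤ.sign i) (nat ℤ.∣ i ∣) ≈ ⟦ i ⟧ℤ
  signed-sign-abs i =
    trans (sym (◃-homo (ℤ.sign i) ℤ.∣ i ∣)) (reflexive (≡.cong ⟦_⟧ℤ (ℤ.◃-inverse i)))

  *-homo : ∀ i j → ⟦ i ℤ.* j ⟧ℤ ≈ ⟦ i ⟧ℤ * ⟦ j ⟧ℤ
  *-homo i j = begin
    ⟦ sᵢ Sign.* sⱼ ◃ ∣i∣ ℕ.* ∣j∣ ⟧ℤ             ≈⟨ ◃-homo (sᵢ Sign.* sⱼ) (∣i∣ ℕ.* ∣j∣) ⟩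
    signed (sᵢ Sign.* sⱼ) (nat (∣i∣ ℕ.* ∣j∣))    ≈⟨ signed-cong (sᵢ Sign.* sⱼ) (nat-* ∣i∣ ∣j∣) ⟩
    signed (sᵢ Sign.* sⱼ) (nat ∣i∣ * nat ∣j∣)    ≈⟨ signed-* sᵢ sⱼ _ _ ⟩
    signed sᵢ (nat ∣i∣) * signed sⱼ (nat ∣j∣)    ≈⟨ *-cong (signed-sign-abs i) (signed-sign-abs j) ⟩
    ⟦ i ⟧ℤ * ⟦ j ⟧ℤ                              ∎
    where
    sᵢ sⱼ : Sign
    sᵢ = ℤ.sign i
    sⱼ = ℤ.sign j
    ∣i∣ ∣j∣ : ℕ
    ∣i∣ = ℤ.∣ i ∣
    ∣j∣ = ℤ.∣ j ∣

  morphism : ℤ.+-*-rawRing -Raw-AlmostCommutative⟶ fromCommutativeRing R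
  morphism = record
    { ⟦_⟧ = ⟦_⟧ℤ ; +-homo = +-homo ; *-homo = *-homo ; -‿homo = -‿homo
    ; 0-homo = refl ; 1-homo = +-identityʳ 1# }

  ⟦_⟧ℤ-≟ : ∀ i j → Maybe (⟦ i ⟧ℤ ≈ ⟦ j ⟧ℤ)
  ⟦ i ⟧ℤ-≟ j = Maybe.map (λ { ≡.refl → refl }) (dec⇒weaklyDec ℤ._≟_ i j)

  open import Algebra.Solver.Ring ℤ.+-*-rawRing (fromCommutativeRing R) morphism ⟦_⟧ℤ-≟ public
    using (Polynomial; solve; _:=_; _:+_; _:*_; _:-_; :-_; _:^_; con)

-- Stated over a raw ring so that the same definitions serve as ring elements and as
-- solver syntax (Polynomial n), the latter evaluating definitionally to the former.
-- Over the scalars, W₂ p is definitionally w₂ of the invariants of p, and likewise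
-- for 𝔚₃, 𝔙₃, 𝔙₂, W₄, 𝔚₄ and W₆.
module InvariantPolynomials {c ℓ} (R : RawRing c ℓ) (#_ : ℕ → RawRing.Carrier R) where
  open RawRing R

  infixl 6 _-_
  _-_ : Carrier → Carrier → Carrier
  x - y = x + - y

  cube : Carrier → Carrier
  cube x = x * x * x

  record Invariants : Set c where
    constructor mkInvariants
    field s e₂ e₃ f P Q : Carrier

  invariantsOf : (x y z f q₁ q₂ : Carrier) → Invariants
  invariantsOf x y z f q₁ q₂ =
    mkInvariants (x + y + z) (x * y + y * z + z * x) (x * y * z) f (q₁ * q₂) (cube q₁ + cube q₂)

  module _ (I : Invariants) where
    open Invariants I

    𝔴₃ 𝔳₃ 𝔳₂ w₂ w₄ 𝔴₄ w₆ disc₂ disc₃ : Carrier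
    𝔴₃ = e₃ - cube f
    𝔳₃ = Q - (s + # 6 * f) * e₂ - # 6 * (f * f) * s - # 9 * cube f
    𝔳₂ = P - e₂ - f * s - # 3 * (f * f)
    w₂ = s * s - # 12 * e₂
    w₄ = s * (cube s + # 216 * e₃)
    𝔴₄ = f * (# 27 * e₃ - cube s)
    w₆ = cube s * cube s - # 540 * e₃ * cube s - # 5832 * (e₃ * e₃)
    disc₂ = Q * Q - # 4 * cube P
    disc₃ = s * s * e₂ * e₂ - # 4 * cube e₂ - # 4 * cube s * e₃
          + # 18 * s * e₂ * e₃ - # 27 * (e₃ * e₃)

  E : Carrier → Invariants → Invariants
  E t I = mkInvariants
    (# 3 * (t * a))
    (t * t * (# 3 * (a * a) - # 27 * P))
    (t * t * t * (cube a + # 27 * Q - # 27 * a * P))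
    (t * (s - # 3 * f))
    (# 9 * (t * t) * (s * s - # 3 * e₂))
    (# 27 * (t * t * t) * (# 2 * cube s - # 9 * s * e₂ + # 27 * e₃))
    where
    open Invariants I
    a : Carrier
    a = s + # 6 * f

  -- 𝔚₃ = 𝔙₃ = 𝔙₂ = 0 solved for e₃, P and Q.
  onSurface : (s e₂ f : Carrier) → Invariants
  onSurface s e₂ f = mkInvariants s e₂ (cube f) f
    (e₂ + f * s + # 3 * (f * f))
    ((s + # 6 * f) * e₂ + # 6 * (f * f) * s + # 9 * cube f)

  -- With {u, v} = {ω, ω̄} these are the coordinates of mapE: X, Y, Z are untwisted,
  -- twisted ω̄ ω and twisted ω ω̄ at a = s + 6φ, b = Q₁, c = Q₂, and Q₁, Q₂ are the twisted
  -- forms at a = 3X, b = Y, c = Z. pair-sum and pair-product are the sum and product of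
  -- the two twisted forms once u + v = -1 and uv = 1.
  twisted : (u v t a b c : Carrier) → Carrier
  twisted u v t a b c = t * (a + # 3 * (u * b) + # 3 * (v * c))

  untwisted pair-sum pair-product : (t a b c : Carrier) → Carrier
  untwisted t a b c = t * (a + # 3 * b + # 3 * c)
  pair-sum t a b c = t * (# 2 * a - # 3 * b - # 3 * c)
  pair-product t a b c =
    t * t * (a * a + # 9 * (b * b) + # 9 * (c * c) - # 3 * (a * b) - # 3 * (a * c) - # 9 * (b * c))

  open Invariants public

module Hessian {c ℓ} (K : Scalars c ℓ) where
  open Scalars K
  open Geometry K
  open import Algebra.Properties.Ring ring
    using (-0#≈0#; -‿involutive; x∙y⁻¹≈ε⇒x≈y; x≈y⇒x∙y⁻¹≈ε)
  open import Algebra.Properties.Semiring.Exp semiring using (_^_)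
  open import Relation.Binary.Reasoning.Setoid setoid
  open IntegerCoefficients R using (Polynomial; solve; _:=_; _:+_; _:*_; _:-_; :-_; _:^_; con)
  open InvariantPolynomials rawRing nat hiding (_-_)

  κ : ∀ {n} → ℕ → Polynomial n
  κ k = con (+ k)

  polynomials : ℕ → RawRing _ _
  polynomials n = record
    { Carrier = Polynomial n ; _≈_ = _≡_ ; _+_ = _:+_ ; _*_ = _:*_ ; -_ = :-_
    ; 0# = κ 0 ; 1# = κ 1 }

  module 𝒫 {n} = InvariantPolynomials (polynomials n) κ

  1#≉0# : 1# ≉ 0#
  1#≉0# 1≈0 = char0 0 (trans (+-identityʳ 1#) 1≈0)

  *-≉0 : ∀ {x y} → x ≉ 0# → y ≉ 0# → x * y ≉ 0#
  *-≉0 x≉0 y≉0 xy≈0 with integral _ _ xy≈0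
  ... | inj₁ x≈0 = x≉0 x≈0
  ... | inj₂ y≈0 = y≉0 y≈0

  -‿≉0 : ∀ {x} → x ≉ 0# → - x ≉ 0#
  -‿≉0 {x} x≉0 -x≈0 = x≉0 (begin
    x     ≈⟨ -‿involutive x ⟨
    - - x ≈⟨ -‿cong -x≈0 ⟩
    - 0#  ≈⟨ -0#≈0# ⟩
    0#    ∎)

  ^-≉0 : ∀ {x} → x ≉ 0# → ∀ n → x ^ n ≉ 0#
  ^-≉0 x≉0 zero    = 1#≉0#
  ^-≉0 x≉0 (suc n) = *-≉0 x≉0 (^-≉0 x≉0 n)

  t≉0 : t ≉ 0#
  t≉0 t≈0 = 1#≉0# (begin
    1#                 ≈⟨ t-inv ⟨
    t * (r * (r * r))  ≈⟨ *-congʳ t≈0 ⟩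
    0# * (r * (r * r)) ≈⟨ zeroˡ _ ⟩
    0#                 ∎)

  n·tᵏ≉0 : ∀ n k → nat (suc n) * t ^ k ≉ 0#
  n·tᵏ≉0 n k = *-≉0 (char0 n) (^-≉0 t≉0 k)

  ≉0-cancelˡ : ∀ {x y} → x ≉ 0# → x * y ≈ 0# → y ≈ 0#
  ≉0-cancelˡ x≉0 xy≈0 with integral _ _ xy≈0
  ... | inj₁ x≈0 = ⊥-elim (x≉0 x≈0)
  ... | inj₂ y≈0 = y≈0

  x≈0⇔x*x≈0 : ∀ {x} → (x ≈ 0# ⇔ x * x ≈ 0#)
  x≈0⇔x*x≈0 = mk⇔ (λ x≈0 → trans (*-congʳ x≈0) (zeroˡ _)) (λ xx≈0 → reduce (integral _ _ xx≈0))

  x≈y⇒x≈0⇔y≈0 : ∀ {x y} → x ≈ y → (x ≈ 0# ⇔ y ≈ 0#)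
  x≈y⇒x≈0⇔y≈0 x≈y = mk⇔ (trans (sym x≈y)) (trans x≈y)

  y≈ux⇒x≈0⇔y≈0 : ∀ {u x y} → u ≉ 0# → y ≈ u * x → (x ≈ 0# ⇔ y ≈ 0#)
  y≈ux⇒x≈0⇔y≈0 u≉0 y≈ux = mk⇔
    (λ x≈0 → trans y≈ux (trans (*-congˡ x≈0) (zeroʳ _)))
    (λ y≈0 → ≉0-cancelˡ u≉0 (trans (sym y≈ux) y≈0))

  y≈ux+kz⇒x≈0⇔y≈0 : ∀ {u k x y z} → u ≉ 0# → z ≈ 0# → y ≈ u * x + k * z → (x ≈ 0# ⇔ y ≈ 0#)
  y≈ux+kz⇒x≈0⇔y≈0 u≉0 z≈0 y≈ux+kz = y≈ux⇒x≈0⇔y≈0 u≉0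
    (trans y≈ux+kz (trans (+-congˡ (trans (*-congˡ z≈0) (zeroʳ _))) (+-identityʳ _)))

  x-a-b-c≈0⇒x≈a+b+c : ∀ {x a b c} → x - a - b - c ≈ 0# → x ≈ a + b + c
  x-a-b-c≈0⇒x≈a+b+c {x} {a} {b} {c} x-a-b-c≈0 = x∙y⁻¹≈ε⇒x≈y x (a + b + c) (trans
    (solve 4 (λ x a b c → x :- (a :+ b :+ c) := x :- a :- b :- c) refl x a b c) x-a-b-c≈0)

  -- u and v are the two roots of T² + T + 1. The relations are written with nat 1
  -- because κ 1 evaluates to nat 1 = 1# + 0#, not to 1#.
  module ConjugatePair (u v : Carrier) (u+v+1≈0 : u + v + nat 1 ≈ 0#) (uv≈1 : u * v ≈ nat 1) where

    -- An identity modulo the relations is certified by its cofactors k₁ and k₂, which are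
    -- read off from the solver-checked polynomial identity.
    by-relations : ∀ {x y k₁ k₂} → x ≈ y + (u + v + nat 1) * k₁ + (u * v - nat 1) * k₂ → x ≈ y
    by-relations {x} {y} {k₁} {k₂} x≈ = begin
      x
        ≈⟨ x≈ ⟩
      y + (u + v + nat 1) * k₁ + (u * v - nat 1) * k₂
        ≈⟨ +-cong (+-congˡ (*-congʳ u+v+1≈0)) (*-congʳ (x≈y⇒x∙y⁻¹≈ε uv≈1)) ⟩
      y + 0# * k₁ + 0# * k₂
        ≈⟨ solve 3 (λ y k₁ k₂ → y :+ κ 0 :* k₁ :+ κ 0 :* k₂ := y) refl y k₁ k₂ ⟩
      y
        ∎

    twisted-+ : ∀ t a b c → twisted v u t a b c + twisted u v t a b c ≈ pair-sum t a b c
    twisted-+ t a b c = by-relations (solve 6 (λ u v t a b c →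
      𝒫.twisted v u t a b c :+ 𝒫.twisted u v t a b c
        := 𝒫.pair-sum t a b c :+ (u :+ v :+ κ 1) :* (κ 3 :* t :* (b :+ c)) :+ (u :* v :- κ 1) :* κ 0)
      refl u v t a b c)

    twisted-* : ∀ t a b c → twisted v u t a b c * twisted u v t a b c ≈ pair-product t a b c
    twisted-* t a b c = by-relations (solve 6 (λ u v t a b c →
      𝒫.twisted v u t a b c :* 𝒫.twisted u v t a b c
        := 𝒫.pair-product t a b c
           :+ (u :+ v :+ κ 1)
              :* (t :* t :* (κ 3 :* (a :* b) :+ κ 3 :* (a :* c) :+ κ 9 :* (b :* c) :* (u :+ v :- κ 1)))
           :+ (u :* v :- κ 1) :* (t :* t :* (κ 9 :* (b :* b) :+ κ 9 :* (c :* c) :- κ 18 :* (b :* c))))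
      refl u v t a b c)

    [u-v]²≈-3 : (u - v) * (u - v) ≈ - nat 3
    [u-v]²≈-3 = by-relations (solve 2 (λ u v →
      (u :- v) :* (u :- v) := :- κ 3 :+ (u :+ v :+ κ 1) :* (u :+ v :- κ 1) :+ (u :* v :- κ 1) :* :- κ 4)
      refl u v)

    conjugate-product : ∀ b c → v * b * (u * c) ≈ b * c
    conjugate-product b c = by-relations (solve 4 (λ u v b c →
      v :* b :* (u :* c) := b :* c :+ (u :+ v :+ κ 1) :* κ 0 :+ (u :* v :- κ 1) :* (b :* c))
      refl u v b c)

    conjugate-cubes : ∀ b c → cube (v * b) + cube (u * c) ≈ cube b + cube c
    conjugate-cubes b c = by-relations (solve 4 (λ u v b c →
      𝒫.cube (v :* b) :+ 𝒫.cube (u :* c)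
        := 𝒫.cube b :+ 𝒫.cube c
           :+ (u :+ v :+ κ 1) :* (𝒫.cube b :* (v :* (v :- κ 1)) :+ 𝒫.cube c :* (u :* (u :- κ 1)))
           :+ (u :* v :- κ 1) :* :- (𝒫.cube b :* (v :- κ 1) :+ 𝒫.cube c :* (u :- κ 1)))
      refl u v b c)

  ω²+ω+1≈0 : ω * ω + ω + nat 1 ≈ 0#
  ω²+ω+1≈0 = trans (+-congˡ (+-identityʳ 1#)) ω-cube

  ω+ω̄+1≈0 : ω + ω̄ + nat 1 ≈ 0#
  ω+ω̄+1≈0 = trans (+-congʳ (+-comm ω ω̄)) ω²+ω+1≈0

  ω*ω̄≈1 : ω * ω̄ ≈ nat 1
  ω*ω̄≈1 = begin
    ω * (ω * ω)
      ≈⟨ solve 1 (λ w → w :* (w :* w) := κ 1 :+ (w :- κ 1) :* (w :* w :+ w :+ κ 1)) refl ω ⟩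
    nat 1 + (ω - nat 1) * (ω * ω + ω + nat 1)
      ≈⟨ +-congˡ (trans (*-congˡ ω²+ω+1≈0) (zeroʳ _)) ⟩
    nat 1 + 0#
      ≈⟨ +-identityʳ _ ⟩
    nat 1
      ∎

  open ConjugatePair ω ω̄ ω+ω̄+1≈0 ω*ω̄≈1

  ω-ω̄≉0 : ω - ω̄ ≉ 0#
  ω-ω̄≉0 ω-ω̄≈0 = -‿≉0 (char0 2) (begin
    - nat 3           ≈⟨ [u-v]²≈-3 ⟨
    (ω - ω̄) * (ω - ω̄) ≈⟨ *-congʳ ω-ω̄≈0 ⟩
    0# * (ω - ω̄)      ≈⟨ zeroˡ _ ⟩
    0#                ∎)

  σ₂-split : ∀ x y z → x * y + y * z + z * x ≈ x * (y + z) + y * z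
  σ₂-split = solve 3 (λ x y z → x :* y :+ y :* z :+ z :* x := x :* (y :+ z) :+ y :* z) refl

  cube-+ : ∀ x y → cube x + cube y ≈ cube (x + y) - nat 3 * (x * y) * (x + y)
  cube-+ = solve 2 (λ x y → 𝒫.cube x :+ 𝒫.cube y := 𝒫.cube (x :+ y) :- κ 3 :* (x :* y) :* (x :+ y)) refl

  vandermonde-split : ∀ x y z → (x - y) * (y - z) * (z - x) ≈ (z - y) * (x * x - x * (y + z) + y * z)
  vandermonde-split = solve 3 (λ x y z →
    (x :- y) :* (y :- z) :* (z :- x) := (z :- y) :* (x :* x :- x :* (y :+ z) :+ y :* z)) refl

  fourier-σ₁ : ∀ t a b c → untwisted t a b c + pair-sum t a b c ≈ nat 3 * (t * a)
  fourier-σ₁ = solve 4 (λ t a b c → 𝒫.untwisted t a b c :+ 𝒫.pair-sum t a b c := κ 3 :* (t :* a)) refl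

  fourier-σ₂ : ∀ t a b c → untwisted t a b c * pair-sum t a b c + pair-product t a b c
                           ≈ t * t * (nat 3 * (a * a) - nat 27 * (b * c))
  fourier-σ₂ = solve 4 (λ t a b c →
    𝒫.untwisted t a b c :* 𝒫.pair-sum t a b c :+ 𝒫.pair-product t a b c
      := t :* t :* (κ 3 :* (a :* a) :- κ 27 :* (b :* c))) refl

  fourier-σ₃ : ∀ t a b c → untwisted t a b c * pair-product t a b c
                           ≈ t * t * t * (cube a + nat 27 * (cube b + cube c) - nat 27 * a * (b * c))
  fourier-σ₃ = solve 4 (λ t a b c →
    𝒫.untwisted t a b c :* 𝒫.pair-product t a b c
      := t :* t :* t :* (𝒫.cube a :+ κ 27 :* (𝒫.cube b :+ 𝒫.cube c) :- κ 27 :* a :* (b :* c))) refl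

  fourier-norm : ∀ t x y z f q₁ q₂ → pair-product t (nat 3 * x) y z ≈ P (E t (invariantsOf x y z f q₁ q₂))
  fourier-norm = solve 7 (λ t x y z f q₁ q₂ →
    𝒫.pair-product t (κ 3 :* x) y z := 𝒫.P (𝒫.E t (𝒫.invariantsOf x y z f q₁ q₂))) refl

  fourier-cubes : ∀ t x y z f q₁ q₂ →
    let σ = pair-sum t (nat 3 * x) y z ; π = pair-product t (nat 3 * x) y z in
    cube σ - nat 3 * π * σ ≈ Q (E t (invariantsOf x y z f q₁ q₂))
  fourier-cubes = solve 7 (λ t x y z f q₁ q₂ →
    let σ = 𝒫.pair-sum t (κ 3 :* x) y z ; π = 𝒫.pair-product t (κ 3 :* x) y z in
    𝒫.cube σ :- κ 3 :* π :* σ := 𝒫.Q (𝒫.E t (𝒫.invariantsOf x y z f q₁ q₂))) refl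

  fourier-vandermonde : ∀ u v t a b c →
    (twisted u v t a b c - twisted v u t a b c)
      * (untwisted t a b c * untwisted t a b c - untwisted t a b c * pair-sum t a b c + pair-product t a b c)
      ≈ nat 81 * t ^ 3 * (u - v) * (cube b - cube c)
  fourier-vandermonde = solve 6 (λ u v t a b c →
    (𝒫.twisted u v t a b c :- 𝒫.twisted v u t a b c)
      :* (𝒫.untwisted t a b c :* 𝒫.untwisted t a b c :- 𝒫.untwisted t a b c :* 𝒫.pair-sum t a b c
          :+ 𝒫.pair-product t a b c)
      := κ 81 :* t :^ 3 :* (u :- v) :* (𝒫.cube b :- 𝒫.cube c)) refl

  𝔳₂-E : ∀ t I → 𝔳₂ (E t I) ≈ nat 27 * t ^ 2 * 𝔳₂ I
  𝔳₂-E t I = solve 7 (λ t s e₂ e₃ f P Q → let I = 𝒫.mkInvariants s e₂ e₃ f P Q in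
    𝒫.𝔳₂ (𝒫.E t I) := κ 27 :* t :^ 2 :* 𝒫.𝔳₂ I)
    refl t (s I) (e₂ I) (e₃ I) (f I) (P I) (Q I)

  𝔴₃-E : ∀ t I → 𝔴₃ (E t I) ≈ nat 27 * t ^ 3 * 𝔳₃ I + - (nat 27 * t ^ 3 * (s I + nat 6 * f I)) * 𝔳₂ I
  𝔴₃-E t I = solve 7 (λ t s e₂ e₃ f P Q → let I = 𝒫.mkInvariants s e₂ e₃ f P Q in
    𝒫.𝔴₃ (𝒫.E t I) := κ 27 :* t :^ 3 :* 𝒫.𝔳₃ I :+ :- (κ 27 :* t :^ 3 :* (s :+ κ 6 :* f)) :* 𝒫.𝔳₂ I)
    refl t (s I) (e₂ I) (e₃ I) (f I) (P I) (Q I)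

  𝔳₃-E : ∀ t I → 𝔳₃ (E t I) ≈ nat 729 * t ^ 3 * 𝔴₃ I + nat 243 * t ^ 3 * s I * 𝔳₂ I
  𝔳₃-E t I = solve 7 (λ t s e₂ e₃ f P Q → let I = 𝒫.mkInvariants s e₂ e₃ f P Q in
    𝒫.𝔳₃ (𝒫.E t I) := κ 729 :* t :^ 3 :* 𝒫.𝔴₃ I :+ κ 243 :* t :^ 3 :* s :* 𝒫.𝔳₂ I)
    refl t (s I) (e₂ I) (e₃ I) (f I) (P I) (Q I)

  w₂-E : ∀ t s e₂ f → w₂ (E t (onSurface s e₂ f)) ≈ - (nat 27 * t ^ 2) * w₂ (onSurface s e₂ f)
  w₂-E = solve 4 (λ t s e₂ f → let I = 𝒫.onSurface s e₂ f in
    𝒫.w₂ (𝒫.E t I) := :- (κ 27 :* t :^ 2) :* 𝒫.w₂ I) refl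

  w₄-E : ∀ t s e₂ f → w₄ (E t (onSurface s e₂ f)) ≈ nat 729 * t ^ 4 * w₄ (onSurface s e₂ f)
  w₄-E = solve 4 (λ t s e₂ f → let I = 𝒫.onSurface s e₂ f in
    𝒫.w₄ (𝒫.E t I) := κ 729 :* t :^ 4 :* 𝒫.w₄ I) refl

  𝔴₄-E : ∀ t s e₂ f → 𝔴₄ (E t (onSurface s e₂ f)) ≈ nat 729 * t ^ 4 * 𝔴₄ (onSurface s e₂ f)
  𝔴₄-E = solve 4 (λ t s e₂ f → let I = 𝒫.onSurface s e₂ f in
    𝒫.𝔴₄ (𝒫.E t I) := κ 729 :* t :^ 4 :* 𝒫.𝔴₄ I) refl

  w₆-E : ∀ t s e₂ f → w₆ (E t (onSurface s e₂ f)) ≈ - (nat 19683 * t ^ 6) * w₆ (onSurface s e₂ f)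
  w₆-E = solve 4 (λ t s e₂ f → let I = 𝒫.onSurface s e₂ f in
    𝒫.w₆ (𝒫.E t I) := :- (κ 19683 :* t :^ 6) :* 𝒫.w₆ I) refl

  disc₂≈disc₃-onSurface : ∀ s e₂ f → disc₂ (onSurface s e₂ f) ≈ disc₃ (onSurface s e₂ f)
  disc₂≈disc₃-onSurface = solve 3 (λ s e₂ f →
    𝒫.disc₂ (𝒫.onSurface s e₂ f) := 𝒫.disc₃ (𝒫.onSurface s e₂ f)) refl

  invariants : Pt → Invariants
  invariants p = invariantsOf (X p) (Y p) (Z p) (φ p) (Q₁ p) (Q₂ p)

  surfaceInvariants : Pt → Invariants
  surfaceInvariants p = onSurface (s (invariants p)) (e₂ (invariants p)) (φ p)

  [Q₁³-Q₂³]²≈disc₂ : ∀ p → (cube (Q₁ p) - cube (Q₂ p)) * (cube (Q₁ p) - cube (Q₂ p)) ≈ disc₂ (invariants p)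
  [Q₁³-Q₂³]²≈disc₂ (pt x y z f q₁ q₂) = solve 6 (λ x y z f q₁ q₂ →
    (𝒫.cube q₁ :- 𝒫.cube q₂) :* (𝒫.cube q₁ :- 𝒫.cube q₂) := 𝒫.disc₂ (𝒫.invariantsOf x y z f q₁ q₂))
    refl x y z f q₁ q₂

  disc₃≈W₃² : ∀ p → disc₃ (invariants p) ≈ W₃ p * W₃ p
  disc₃≈W₃² (pt x y z f q₁ q₂) = solve 6 (λ x y z f q₁ q₂ →
    𝒫.disc₃ (𝒫.invariantsOf x y z f q₁ q₂)
      := (x :- y) :* (y :- z) :* (z :- x) :* ((x :- y) :* (y :- z) :* (z :- x)))
    refl x y z f q₁ q₂

  infix 4 _≈ᵢ_
  record _≈ᵢ_ (I J : Invariants) : Set ℓ where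
    field
      s≈  : s I ≈ s J
      e₂≈ : e₂ I ≈ e₂ J
      e₃≈ : e₃ I ≈ e₃ J
      f≈  : f I ≈ f J
      P≈  : P I ≈ P J
      Q≈  : Q I ≈ Q J

  infixl 6 _⟨+⟩_ _⟨-⟩_
  infixl 7 _⟨*⟩_

  _⟨+⟩_ : ∀ {x y z w} → x ≈ y → z ≈ w → x + z ≈ y + w
  _⟨+⟩_ = +-cong

  _⟨-⟩_ : ∀ {x y z w} → x ≈ y → z ≈ w → x - z ≈ y - w
  x≈y ⟨-⟩ z≈w = +-cong x≈y (-‿cong z≈w)

  _⟨*⟩_ : ∀ {x y z w} → x ≈ y → z ≈ w → x * z ≈ y * w
  _⟨*⟩_ = *-cong

  ⟨cube⟩ : ∀ {x y} → x ≈ y → cube x ≈ cube y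
  ⟨cube⟩ x≈y = x≈y ⟨*⟩ x≈y ⟨*⟩ x≈y

  module _ {I J : Invariants} (I≈J : I ≈ᵢ J) where
    open _≈ᵢ_ I≈J

    𝔴₃-cong : 𝔴₃ I ≈ 𝔴₃ J
    𝔴₃-cong = e₃≈ ⟨-⟩ ⟨cube⟩ f≈

    𝔳₃-cong : 𝔳₃ I ≈ 𝔳₃ J
    𝔳₃-cong = Q≈ ⟨-⟩ (s≈ ⟨+⟩ *-congˡ f≈) ⟨*⟩ e₂≈ ⟨-⟩ *-congˡ (f≈ ⟨*⟩ f≈) ⟨*⟩ s≈ ⟨-⟩ *-congˡ (⟨cube⟩ f≈)

    𝔳₂-cong : 𝔳₂ I ≈ 𝔳₂ J
    𝔳₂-cong = P≈ ⟨-⟩ e₂≈ ⟨-⟩ f≈ ⟨*⟩ s≈ ⟨-⟩ *-congˡ (f≈ ⟨*⟩ f≈)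

    w₂-cong : w₂ I ≈ w₂ J
    w₂-cong = s≈ ⟨*⟩ s≈ ⟨-⟩ *-congˡ e₂≈

    w₄-cong : w₄ I ≈ w₄ J
    w₄-cong = s≈ ⟨*⟩ (⟨cube⟩ s≈ ⟨+⟩ *-congˡ e₃≈)

    𝔴₄-cong : 𝔴₄ I ≈ 𝔴₄ J
    𝔴₄-cong = f≈ ⟨*⟩ (*-congˡ e₃≈ ⟨-⟩ ⟨cube⟩ s≈)

    w₆-cong : w₆ I ≈ w₆ J
    w₆-cong = ⟨cube⟩ s≈ ⟨*⟩ ⟨cube⟩ s≈ ⟨-⟩ *-congˡ e₃≈ ⟨*⟩ ⟨cube⟩ s≈ ⟨-⟩ *-congˡ (e₃≈ ⟨*⟩ e₃≈)

    disc₂-cong : disc₂ I ≈ disc₂ J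
    disc₂-cong = Q≈ ⟨*⟩ Q≈ ⟨-⟩ *-congˡ (⟨cube⟩ P≈)

    disc₃-cong : disc₃ I ≈ disc₃ J
    disc₃-cong = s≈ ⟨*⟩ s≈ ⟨*⟩ e₂≈ ⟨*⟩ e₂≈ ⟨-⟩ *-congˡ (⟨cube⟩ e₂≈) ⟨-⟩ *-congˡ (⟨cube⟩ s≈) ⟨*⟩ e₃≈
               ⟨+⟩ *-congˡ s≈ ⟨*⟩ e₂≈ ⟨*⟩ e₃≈ ⟨-⟩ *-congˡ (e₃≈ ⟨*⟩ e₃≈)

    E-cong : ∀ t → E t I ≈ᵢ E t J
    E-cong t = record
      { s≈  = *-congˡ (*-congˡ a≈)
      ; e₂≈ = *-congˡ (*-congˡ (a≈ ⟨*⟩ a≈) ⟨-⟩ *-congˡ P≈)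
      ; e₃≈ = *-congˡ (⟨cube⟩ a≈ ⟨+⟩ *-congˡ Q≈ ⟨-⟩ *-congˡ a≈ ⟨*⟩ P≈)
      ; f≈  = *-congˡ (s≈ ⟨-⟩ *-congˡ f≈)
      ; P≈  = *-congˡ (s≈ ⟨*⟩ s≈ ⟨-⟩ *-congˡ e₂≈)
      ; Q≈  = *-congˡ (*-congˡ (⟨cube⟩ s≈) ⟨-⟩ *-congˡ s≈ ⟨*⟩ e₂≈ ⟨+⟩ *-congˡ e₃≈)
      }
      where
      a≈ : s I + nat 6 * f I ≈ s J + nat 6 * f J
      a≈ = s≈ ⟨+⟩ *-congˡ f≈

  invariants-cong : ∀ {p q} → p ≈ₚ q → invariants p ≈ᵢ invariants q
  invariants-cong (x≈ , y≈ , z≈ , f≈ , q₁≈ , q₂≈) = record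
    { s≈  = x≈ ⟨+⟩ y≈ ⟨+⟩ z≈
    ; e₂≈ = x≈ ⟨*⟩ y≈ ⟨+⟩ y≈ ⟨*⟩ z≈ ⟨+⟩ z≈ ⟨*⟩ x≈
    ; e₃≈ = x≈ ⟨*⟩ y≈ ⟨*⟩ z≈
    ; f≈  = f≈
    ; P≈  = q₁≈ ⟨*⟩ q₂≈
    ; Q≈  = ⟨cube⟩ q₁≈ ⟨+⟩ ⟨cube⟩ q₂≈
    }

  W₃-cong : ∀ {p q} → p ≈ₚ q → W₃ p ≈ W₃ q
  W₃-cong (x≈ , y≈ , z≈ , _) = (x≈ ⟨-⟩ y≈) ⟨*⟩ (y≈ ⟨-⟩ z≈) ⟨*⟩ (z≈ ⟨-⟩ x≈)

  ≈ₚ-sym : ∀ {p q} → p ≈ₚ q → q ≈ₚ p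
  ≈ₚ-sym (x≈ , y≈ , z≈ , f≈ , q₁≈ , q₂≈) = sym x≈ , sym y≈ , sym z≈ , sym f≈ , sym q₁≈ , sym q₂≈

  surface-invariants : ∀ {p} → Surf p → invariants p ≈ᵢ surfaceInvariants p
  surface-invariants (𝔚₃≈0 , 𝔙₃≈0 , 𝔙₂≈0) = record
    { s≈  = refl
    ; e₂≈ = refl
    ; e₃≈ = x∙y⁻¹≈ε⇒x≈y _ _ 𝔚₃≈0
    ; f≈  = refl
    ; P≈  = x-a-b-c≈0⇒x≈a+b+c 𝔙₂≈0
    ; Q≈  = x-a-b-c≈0⇒x≈a+b+c 𝔙₃≈0
    }

  invariants-A : ∀ p → invariants (mapA p) ≈ᵢ invariants p
  invariants-A (pt x y z _ _ _) = record
    { s≈  = solve 3 (λ x y z → y :+ z :+ x := x :+ y :+ z) refl x y z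
    ; e₂≈ = solve 3 (λ x y z → y :* z :+ z :* x :+ x :* y := x :* y :+ y :* z :+ z :* x) refl x y z
    ; e₃≈ = solve 3 (λ x y z → y :* z :* x := x :* y :* z) refl x y z
    ; f≈  = refl
    ; P≈  = refl
    ; Q≈  = refl
    }

  invariants-B : ∀ p → invariants (mapB p) ≈ᵢ invariants p
  invariants-B (pt x y z _ q₁ q₂) = record
    { s≈  = solve 3 (λ x y z → x :+ z :+ y := x :+ y :+ z) refl x y z
    ; e₂≈ = solve 3 (λ x y z → x :* z :+ z :* y :+ y :* x := x :* y :+ y :* z :+ z :* x) refl x y z
    ; e₃≈ = solve 3 (λ x y z → x :* z :* y := x :* y :* z) refl x y z
    ; f≈  = refl
    ; P≈  = *-comm q₂ q₁
    ; Q≈  = +-comm (cube q₂) (cube q₁)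
    }

  invariants-C : ∀ p → invariants (mapC p) ≈ᵢ invariants p
  invariants-C (pt _ _ _ _ q₁ q₂) = record
    { s≈  = refl
    ; e₂≈ = refl
    ; e₃≈ = refl
    ; f≈  = refl
    ; P≈  = conjugate-product q₁ q₂
    ; Q≈  = conjugate-cubes q₁ q₂
    }

  Q-mapE : ∀ p → Q (invariants (mapE p)) ≈ Q (E t (invariants p))
  Q-mapE (pt x y z f q₁ q₂) = begin
    cube Q₁′ + cube Q₂′                                 ≈⟨ cube-+ Q₁′ Q₂′ ⟩
    cube (Q₁′ + Q₂′) - nat 3 * (Q₁′ * Q₂′) * (Q₁′ + Q₂′) ≈⟨ ⟨cube⟩ Q₁′+Q₂′ ⟨-⟩ *-congˡ Q₁′*Q₂′ ⟨*⟩ Q₁′+Q₂′ ⟩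
    cube σ - nat 3 * π * σ                              ≈⟨ fourier-cubes t x y z f q₁ q₂ ⟩
    Q (E t (invariantsOf x y z f q₁ q₂))                ∎
    where
    Q₁′ Q₂′ σ π : Carrier
    Q₁′ = twisted ω̄ ω t (nat 3 * x) y z
    Q₂′ = twisted ω ω̄ t (nat 3 * x) y z
    σ   = pair-sum t (nat 3 * x) y z
    π   = pair-product t (nat 3 * x) y z

    Q₁′+Q₂′ : Q₁′ + Q₂′ ≈ σ
    Q₁′+Q₂′ = twisted-+ t (nat 3 * x) y z

    Q₁′*Q₂′ : Q₁′ * Q₂′ ≈ π
    Q₁′*Q₂′ = twisted-* t (nat 3 * x) y z

  invariants-E : ∀ p → invariants (mapE p) ≈ᵢ E t (invariants p)
  invariants-E p@(pt x y z f q₁ q₂) = record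
    { s≈  = begin
        X′ + Y′ + Z′            ≈⟨ +-assoc X′ Y′ Z′ ⟩
        X′ + (Y′ + Z′)          ≈⟨ +-congˡ (twisted-+ t a q₁ q₂) ⟩
        X′ + pair-sum t a q₁ q₂ ≈⟨ fourier-σ₁ t a q₁ q₂ ⟩
        nat 3 * (t * a)         ∎
    ; e₂≈ = begin
        X′ * Y′ + Y′ * Z′ + Z′ * X′                       ≈⟨ σ₂-split X′ Y′ Z′ ⟩
        X′ * (Y′ + Z′) + Y′ * Z′                          ≈⟨ *-congˡ (twisted-+ t a q₁ q₂) ⟨+⟩ twisted-* t a q₁ q₂ ⟩
        X′ * pair-sum t a q₁ q₂ + pair-product t a q₁ q₂ ≈⟨ fourier-σ₂ t a q₁ q₂ ⟩
        t * t * (nat 3 * (a * a) - nat 27 * (q₁ * q₂))    ∎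
    ; e₃≈ = begin
        X′ * Y′ * Z′                ≈⟨ *-assoc X′ Y′ Z′ ⟩
        X′ * (Y′ * Z′)              ≈⟨ *-congˡ (twisted-* t a q₁ q₂) ⟩
        X′ * pair-product t a q₁ q₂ ≈⟨ fourier-σ₃ t a q₁ q₂ ⟩
        t * t * t * (cube a + nat 27 * (cube q₁ + cube q₂) - nat 27 * a * (q₁ * q₂)) ∎
    ; f≈  = refl
    ; P≈  = trans (twisted-* t (nat 3 * x) y z) (fourier-norm t x y z f q₁ q₂)
    ; Q≈  = Q-mapE p
    }
    where
    a X′ Y′ Z′ : Carrier
    a  = x + y + z + nat 6 * f
    X′ = untwisted t a q₁ q₂
    Y′ = twisted ω̄ ω t a q₁ q₂
    Z′ = twisted ω ω̄ t a q₁ q₂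

  W₃-E : ∀ p → W₃ (mapE p) ≈ nat 81 * t ^ 3 * (ω - ω̄) * (cube (Q₁ p) - cube (Q₂ p))
  W₃-E (pt x y z f q₁ q₂) = begin
    (X′ - Y′) * (Y′ - Z′) * (Z′ - X′)
      ≈⟨ vandermonde-split X′ Y′ Z′ ⟩
    (Z′ - Y′) * (X′ * X′ - X′ * (Y′ + Z′) + Y′ * Z′)
      ≈⟨ *-congˡ (refl ⟨-⟩ *-congˡ (twisted-+ t a q₁ q₂) ⟨+⟩ twisted-* t a q₁ q₂) ⟩
    (Z′ - Y′) * (X′ * X′ - X′ * pair-sum t a q₁ q₂ + pair-product t a q₁ q₂)
      ≈⟨ fourier-vandermonde ω ω̄ t a q₁ q₂ ⟩
    nat 81 * t ^ 3 * (ω - ω̄) * (cube q₁ - cube q₂)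
      ∎
    where
    a X′ Y′ Z′ : Carrier
    a  = x + y + z + nat 6 * f
    X′ = untwisted t a q₁ q₂
    Y′ = twisted ω̄ ω t a q₁ q₂
    Z′ = twisted ω ω̄ t a q₁ q₂

  Stable : (Pt → Set ℓ) → (Pt → Pt) → Set (c ⊔ ℓ)
  Stable S g = ∀ p → S p ⇔ S (g p)

  generators-stable⇒invariant : ∀ {S} → S Respects _≈ₚ_ →
    Stable S mapA → Stable S mapB → Stable S mapC → Stable S mapE → Invariant S
  generators-stable⇒invariant {S} resp stableA stableB stableC stableE g g∈𝓗 p =
    Equivalence.to (stable g∈𝓗 p)
    where
    resp⇔ : ∀ {p q} → p ≈ₚ q → S p ⇔ S q
    resp⇔ p≈q = mk⇔ (resp p≈q) (resp (≈ₚ-sym p≈q))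

    stable : ∀ {g} → InH g → Stable S g
    stable hA = stableA
    stable hB = stableB
    stable hC = stableC
    stable hE = stableE
    stable hId p = ⇔-id _
    stable (hComp {g = g} f∈𝓗 g∈𝓗) p = stable f∈𝓗 (g p) ⇔-∘ stable g∈𝓗 p
    stable (hInv f∈𝓗 h _ f∘h≈id) p = ⇔-sym (stable f∈𝓗 (h p)) ⇔-∘ resp⇔ (≈ₚ-sym (f∘h≈id p))
    stable (hExt f∈𝓗 g f≈g) p = resp⇔ (f≈g p) ⇔-∘ stable f∈𝓗 p

  surface⇔ : ∀ {p q} → invariants p ≈ᵢ invariants q → Surf p ⇔ Surf q
  surface⇔ I≈J =
    x≈y⇒x≈0⇔y≈0 (𝔴₃-cong I≈J) ×-⇔ x≈y⇒x≈0⇔y≈0 (𝔳₃-cong I≈J) ×-⇔ x≈y⇒x≈0⇔y≈0 (𝔳₂-cong I≈J)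

  surface-stable : ∀ {g} → (∀ p → invariants (g p) ≈ᵢ invariants p) → Stable Surf g
  surface-stable g-fixes p = ⇔-sym (surface⇔ (g-fixes p))

  surface-stable-E : Stable Surf mapE
  surface-stable-E p = mk⇔ forward backward
    where
    𝔙₂⇔ : 𝔙₂ p ≈ 0# ⇔ 𝔙₂ (mapE p) ≈ 0#
    𝔙₂⇔ = y≈ux⇒x≈0⇔y≈0 (n·tᵏ≉0 26 2) (trans (𝔳₂-cong (invariants-E p)) (𝔳₂-E t (invariants p)))

    𝔙₃⇔ : 𝔙₂ p ≈ 0# → (𝔙₃ p ≈ 0# ⇔ 𝔚₃ (mapE p) ≈ 0#)
    𝔙₃⇔ 𝔙₂≈0 = y≈ux+kz⇒x≈0⇔y≈0 (n·tᵏ≉0 26 3) 𝔙₂≈0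
      (trans (𝔴₃-cong (invariants-E p)) (𝔴₃-E t (invariants p)))

    𝔚₃⇔ : 𝔙₂ p ≈ 0# → (𝔚₃ p ≈ 0# ⇔ 𝔙₃ (mapE p) ≈ 0#)
    𝔚₃⇔ 𝔙₂≈0 = y≈ux+kz⇒x≈0⇔y≈0 (n·tᵏ≉0 728 3) 𝔙₂≈0
      (trans (𝔳₃-cong (invariants-E p)) (𝔳₃-E t (invariants p)))

    forward : Surf p → Surf (mapE p)
    forward (𝔚₃≈0 , 𝔙₃≈0 , 𝔙₂≈0) =
      Equivalence.to (𝔙₃⇔ 𝔙₂≈0) 𝔙₃≈0 , Equivalence.to (𝔚₃⇔ 𝔙₂≈0) 𝔚₃≈0 , Equivalence.to 𝔙₂⇔ 𝔙₂≈0

    backward : Surf (mapE p) → Surf p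
    backward (𝔚₃′≈0 , 𝔙₃′≈0 , 𝔙₂′≈0) =
      Equivalence.from (𝔚₃⇔ 𝔙₂≈0) 𝔙₃′≈0 , Equivalence.from (𝔙₃⇔ 𝔙₂≈0) 𝔚₃′≈0 , 𝔙₂≈0
      where
      𝔙₂≈0 : 𝔙₂ p ≈ 0#
      𝔙₂≈0 = Equivalence.from 𝔙₂⇔ 𝔙₂′≈0

  surface-invariant : Invariant Surf
  surface-invariant = generators-stable⇒invariant
    (λ p≈q → Equivalence.to (surface⇔ (invariants-cong p≈q)))
    (surface-stable invariants-A) (surface-stable invariants-B) (surface-stable invariants-C)
    surface-stable-E

  Cut : (Pt → Carrier) → (Pt → Pt) → Set (c ⊔ ℓ)
  Cut F g = ∀ p → Surf p → (F p ≈ 0# ⇔ F (g p) ≈ 0#)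

  cut-invariant : ∀ F → (∀ {p q} → p ≈ₚ q → F p ≈ F q) →
    Cut F mapA → Cut F mapB → Cut F mapC → Cut F mapE → Invariant (SurfCut F)
  cut-invariant F F-cong cutA cutB cutC cutE = generators-stable⇒invariant resp
    (stable (surface-stable invariants-A) cutA) (stable (surface-stable invariants-B) cutB)
    (stable (surface-stable invariants-C) cutC) (stable surface-stable-E cutE)
    where
    resp : SurfCut F Respects _≈ₚ_
    resp p≈q (Σp , Fp≈0) =
      Equivalence.to (surface⇔ (invariants-cong p≈q)) Σp , trans (sym (F-cong p≈q)) Fp≈0

    stable : ∀ {g} → Stable Surf g → Cut F g → Stable (SurfCut F) g
    stable Σ-stable cut p = mk⇔
      (λ (Σp , Fp≈0) → Equivalence.to (Σ-stable p) Σp , Equivalence.to (cut p Σp) Fp≈0)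
      (λ (Σgp , Fgp≈0) → let Σp = Equivalence.from (Σ-stable p) Σgp in
                           Σp , Equivalence.from (cut p Σp) Fgp≈0)

  invariant-cut : ∀ (F : Invariants → Carrier) → (∀ {I J} → I ≈ᵢ J → F I ≈ F J) →
    Cut (λ p → F (invariants p)) mapE → Invariant (SurfCut (λ p → F (invariants p)))
  invariant-cut F F-cong = cut-invariant _ (λ p≈q → F-cong (invariants-cong p≈q))
    (by-invariants invariants-A) (by-invariants invariants-B) (by-invariants invariants-C)
    where
    by-invariants : ∀ {g} → (∀ p → invariants (g p) ≈ᵢ invariants p) → Cut (λ p → F (invariants p)) g
    by-invariants g-fixes p _ = ⇔-sym (x≈y⇒x≈0⇔y≈0 (F-cong (g-fixes p)))

  invariant-cut-E : ∀ {F : Invariants → Carrier} {u} → (∀ {I J} → I ≈ᵢ J → F I ≈ F J) → u ≉ 0# →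
    (∀ s e₂ f → F (E t (onSurface s e₂ f)) ≈ u * F (onSurface s e₂ f)) →
    Cut (λ p → F (invariants p)) mapE
  invariant-cut-E {F} {u} F-cong u≉0 F-E p Σp = y≈ux⇒x≈0⇔y≈0 u≉0 (begin
    F (invariants (mapE p))       ≈⟨ F-cong (invariants-E p) ⟩
    F (E t (invariants p))        ≈⟨ F-cong (E-cong (surface-invariants Σp) t) ⟩
    F (E t (surfaceInvariants p)) ≈⟨ F-E _ _ _ ⟩
    u * F (surfaceInvariants p)   ≈⟨ *-congˡ (F-cong (surface-invariants Σp)) ⟨
    u * F (invariants p)          ∎)

  [Q₁³-Q₂³]²≈W₃² : ∀ {p} → Surf p →
    (cube (Q₁ p) - cube (Q₂ p)) * (cube (Q₁ p) - cube (Q₂ p)) ≈ W₃ p * W₃ p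
  [Q₁³-Q₂³]²≈W₃² {p} Σp = begin
    (cube (Q₁ p) - cube (Q₂ p)) * (cube (Q₁ p) - cube (Q₂ p)) ≈⟨ [Q₁³-Q₂³]²≈disc₂ p ⟩
    disc₂ (invariants p)                                    ≈⟨ disc₂-cong (surface-invariants Σp) ⟩
    disc₂ (surfaceInvariants p)                             ≈⟨ disc₂≈disc₃-onSurface _ _ _ ⟩
    disc₃ (surfaceInvariants p)                             ≈⟨ disc₃-cong (surface-invariants Σp) ⟨
    disc₃ (invariants p)                                    ≈⟨ disc₃≈W₃² p ⟩
    W₃ p * W₃ p                                             ∎

  W₃-A : ∀ p → W₃ (mapA p) ≈ W₃ p
  W₃-A (pt x y z _ _ _) = solve 3 (λ x y z →
    (y :- z) :* (z :- x) :* (x :- y) := (x :- y) :* (y :- z) :* (z :- x)) refl x y z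

  W₃-B : ∀ p → W₃ (mapB p) ≈ - nat 1 * W₃ p
  W₃-B (pt x y z _ _ _) = solve 3 (λ x y z →
    (x :- z) :* (z :- y) :* (y :- x) := :- κ 1 :* ((x :- y) :* (y :- z) :* (z :- x))) refl x y z

  W₃-cut-E : Cut W₃ mapE
  W₃-cut-E p Σp =
    y≈ux⇒x≈0⇔y≈0 (*-≉0 (n·tᵏ≉0 80 3) ω-ω̄≉0) (W₃-E p) ⇔-∘
    (⇔-sym x≈0⇔x*x≈0 ⇔-∘
    (x≈y⇒x≈0⇔y≈0 (sym ([Q₁³-Q₂³]²≈W₃² Σp)) ⇔-∘
    x≈0⇔x*x≈0))

  W₃-invariant : Invariant (SurfCut W₃)
  W₃-invariant = cut-invariant W₃ W₃-cong
    (λ p _ → ⇔-sym (x≈y⇒x≈0⇔y≈0 (W₃-A p)))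
    (λ p _ → y≈ux⇒x≈0⇔y≈0 (-‿≉0 (char0 0)) (W₃-B p))
    (λ p _ → ⇔-id _)
    W₃-cut-E

  W₂-invariant : Invariant (SurfCut W₂)
  W₂-invariant = invariant-cut w₂ w₂-cong (invariant-cut-E w₂-cong (-‿≉0 (n·tᵏ≉0 26 2)) (w₂-E t))

  W₄-invariant : Invariant (SurfCut W₄)
  W₄-invariant = invariant-cut w₄ w₄-cong (invariant-cut-E w₄-cong (n·tᵏ≉0 728 4) (w₄-E t))

  W₆-invariant : Invariant (SurfCut W₆)
  W₆-invariant = invariant-cut w₆ w₆-cong (invariant-cut-E w₆-cong (-‿≉0 (n·tᵏ≉0 19682 6)) (w₆-E t))

  𝔚₄-invariant : Invariant (SurfCut 𝔚₄)
  𝔚₄-invariant = invariant-cut 𝔴₄ 𝔴₄-cong (invariant-cut-E 𝔴₄-cong (n·tᵏ≉0 728 4) (𝔴₄-E t))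

proposition3p20 : ∀ {c ℓ : Level} (K : Scalars c ℓ) → let open Geometry K in
    Invariant Surf ×
    Invariant (SurfCut W₂) × Invariant (SurfCut W₃) × Invariant (SurfCut W₄) ×
    Invariant (SurfCut W₆) × Invariant (SurfCut 𝔚₄)
proposition3p20 K =
  surface-invariant , W₂-invariant , W₃-invariant , W₄-invariant , W₆-invariant , 𝔚₄-invariant
  where open Hessian K
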